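{- Let $\mathcal{F}$ be a crossing biset-family on a finite set $T$. Then $\Delta(\mathcal{C}(\mathcal{F}))\le\nu(\bar{\mathcal{F}})$.
   Context: A biset on $T$ is a pair $\hat X=(X,X^+)$ with $X\subseteq X^+\subseteq T$; $X^*=T\setminus X^+$. $\hat X\cap\hat Y=(X\cap Y,X^+\cap Y^+)$, $\hat X\cup\hat Y=(X\cup Y,X^+\cup Y^+)$; $\hat X,\hat Y$ cross if $X\cap Y\ne\emptyset$ and $X^*\cap Y^*\ne\emptyset$. $\mathcal{F}$ is crossing if $\hat X\cap\hat Y,\hat X\cup\hat Y\in\mathcal{F}$ whenever $\hat X,\hat Y\in\mathcal{F}$ cross. $\bar{\mathcal{F}}=\{(T\setminus X^+,T\setminus X):\hat X\in\mathcal{F}\}$. $\hat X\subseteq\hat Y$ means $X\subsetneq Y$, or $X=Y$ and $X^+\subseteq Y^+$; a core of $\mathcal{F}$ is a member containing no other member of $\mathcal{F}$, and $\mathcal{C}(\mathcal{F})$ is the family of cores. For a biset-family $\mathcal{H}$, $\Delta(\mathcal{H})$ is the maximum, over $v\in T$, of the number of members of $\mathcal{H}$ whose inner part contains $v$. $\nu(\mathcal{F})$ is the maximum number of members of $\mathcal{F}$ whose inner parts are pairwise disjoint. -}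

module Defs where

open import Data.Nat using (ℕ; _≤_)
open import Data.Fin using (Fin)
open import Data.Fin.Subset using (Subset; _∈_; _⊆_; _⊂_; _∩_; _∪_; ∁; Nonempty; Empty)
open import Data.Product using (_×_; _,_; ∃; proj₁; proj₂)
open import Data.Sum using (_⊎_)
open import Data.List using (List; map; length)
import Data.List.Membership.Propositional as LM
open import Data.List.Relation.Unary.All using (All)
open import Data.List.Relation.Unary.AllPairs using (AllPairs)
open import Data.List.Relation.Unary.Unique.Propositional using (Unique)
open import Relation.Binary.PropositionalEquality using (_≡_)

-- A biset on T = Fin n is a pair (X , X⁺) of subsets with X ⊆ X⁺.
-- We represent it by the underlying pair; validity X ⊆ X⁺ is a
-- separate predicate required of every member of a family.
Biset : ℕ → Set
Biset n = Subset n × Subset n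

inner : ∀ {n} → Biset n → Subset n
inner = proj₁

outer : ∀ {n} → Biset n → Subset n
outer = proj₂

IsBiset : ∀ {n} → Biset n → Set
IsBiset (X , X⁺) = X ⊆ X⁺

star : ∀ {n} → Biset n → Subset n
star (X , X⁺) = ∁ X⁺

_∩̂_ : ∀ {n} → Biset n → Biset n → Biset n
(X , X⁺) ∩̂ (Y , Y⁺) = (X ∩ Y , X⁺ ∩ Y⁺)

_∪̂_ : ∀ {n} → Biset n → Biset n → Biset n
(X , X⁺) ∪̂ (Y , Y⁺) = (X ∪ Y , X⁺ ∪ Y⁺)

Cross : ∀ {n} → Biset n → Biset n → Set
Cross A B = Nonempty (inner A ∩ inner B) × Nonempty (star A ∩ star B)

-- A (finite) biset-family on T, given as a list of its members
-- (membership is what matters; repetitions are irrelevant).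
Family : ℕ → Set
Family n = List (Biset n)

_∈F_ : ∀ {n} → Biset n → Family n → Set
A ∈F F = A LM.∈ F

WellFormed : ∀ {n} → Family n → Set
WellFormed F = ∀ A → A ∈F F → IsBiset A

Crossing : ∀ {n} → Family n → Set
Crossing F = ∀ A B → A ∈F F → B ∈F F → Cross A B →
  ((A ∩̂ B) ∈F F) × ((A ∪̂ B) ∈F F)

bar : ∀ {n} → Biset n → Biset n
bar (X , X⁺) = (∁ X⁺ , ∁ X)

barF : ∀ {n} → Family n → Family n
barF F = map bar F

_⊑_ : ∀ {n} → Biset n → Biset n → Set
(X , X⁺) ⊑ (Y , Y⁺) = (X ⊂ Y) ⊎ ((X ≡ Y) × (X⁺ ⊆ Y⁺))

IsCore : ∀ {n} → Family n → Biset n → Set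
IsCore F C = (C ∈F F) × (∀ A → A ∈F F → A ⊑ C → A ≡ C)

Packing : ∀ {n} → Family n → List (Biset n) → Set
Packing F L = Unique L × All (λ A → A ∈F F) L ×
  AllPairs (λ A B → Empty (inner A ∩ inner B)) L

-- Δ(H) ≤ ν(F): for every v ∈ T, the number of members of H whose inner
-- parts contain v is at most the size of some packing in F.
Δ≤ν : ∀ {n} → (Biset n → Set) → Family n → Set
Δ≤ν {n} H F = ∀ (v : Fin n) (L : List (Biset n)) → Unique L →
  All (λ A → H A × v ∈ inner A) L →
  ∃ λ P → Packing F P × length L ≤ length P

module Submission where

-- Fix v ∈ T and a list L of distinct cores of F whose inner parts all
-- contain v.  We show that the bars of the members of L form a packing
-- of F̄, which is as long as L.  The key observation is that two distinct
-- cores never cross: if they did, their intersection would lie in F and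
-- be contained in both, so by minimality it would equal each of them.
-- Two cores sharing v have intersecting inner parts, so, being distinct,
-- their outer complements X* are disjoint — and X* is exactly the inner
-- part of the bar.  Distinctness survives the bar map since it is
-- injective.

open import Data.Nat using (ℕ)
open import Data.Nat.Properties using (≤-reflexive)
open import Data.Bool using (_≟_)
open import Data.Fin using (Fin)
open import Data.Fin.Properties using (¬∀⟶∃¬)
open import Data.Fin.Subset using (Subset; _∈_; _⊆_; _⊂_; _∩_; ∁; Empty)
open import Data.Fin.Subset.Properties
  using (_∈?_; ⊆-antisym; p∩q⊆p; p∩q⊆q; x∈p∩q⁺; x∈p⇒x∉∁p; x∉∁p⇒x∈p)
open import Data.Vec.Properties using (≡-dec)
open import Data.Product using (_×_; _,_; proj₁)
open import Data.Sum using (inj₁; inj₂)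
open import Data.List using (map)
open import Data.List.Properties using (length-map)
open import Data.List.Relation.Unary.All as All using (All; []; _∷_)
import Data.List.Relation.Unary.All.Properties as Allₚ
open import Data.List.Relation.Unary.AllPairs using (AllPairs; []; _∷_)
import Data.List.Relation.Unary.AllPairs.Properties as AllPairsₚ
open import Data.List.Relation.Unary.Unique.Propositional using (Unique)
import Data.List.Relation.Unary.Unique.Propositional.Properties as Uniqueₚ
open import Data.List.Membership.Propositional.Properties using (∈-map⁺)
open import Data.Empty using (⊥-elim)
open import Function using (_∘_)
open import Relation.Binary.PropositionalEquality using (_≡_; _≢_; refl; sym; trans; cong; subst)
open import Relation.Nullary using (yes; no; _→-dec_)

open import Defs

⊆∧≢⇒⊂ : ∀ {n} {p q : Subset n} → p ⊆ q → p ≢ q → p ⊂ q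
⊆∧≢⇒⊂ {n} {p} {q} p⊆q p≢q
  with ¬∀⟶∃¬ n (λ x → x ∈ q → x ∈ p) (λ x → x ∈? q →-dec x ∈? p)
         (λ q⊆p → p≢q (⊆-antisym p⊆q (λ {x} → q⊆p x)))
... | x , x∈q⇏x∈p with x ∈? q
...   | yes x∈q = p⊆q , x , x∈q , λ x∈p → x∈q⇏x∈p (λ _ → x∈p)
...   | no  x∉q = ⊥-elim (x∈q⇏x∈p (⊥-elim ∘ x∉q))

∁-injective : ∀ {n} {p q : Subset n} → ∁ p ≡ ∁ q → p ≡ q
∁-injective ∁p≡∁q =
  ⊆-antisym (∁-reflects-⊆ (λ {x} → subst (x ∈_) (sym ∁p≡∁q)))
            (∁-reflects-⊆ (λ {x} → subst (x ∈_) ∁p≡∁q))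
  where
  ∁-reflects-⊆ : ∀ {r s : Subset _} → ∁ s ⊆ ∁ r → r ⊆ s
  ∁-reflects-⊆ ∁s⊆∁r x∈r = x∉∁p⇒x∈p (x∈p⇒x∉∁p x∈r ∘ ∁s⊆∁r)

bar-injective : ∀ {n} {A B : Biset n} → bar A ≡ bar B → A ≡ B
bar-injective {A = X , X⁺} {Y , Y⁺} bar-eq with ∁-injective (cong outer bar-eq)
                                            | ∁-injective (cong inner bar-eq)
... | refl | refl = refl

⊆⇒⊑ : ∀ {n} (A B : Biset n) → inner A ⊆ inner B → outer A ⊆ outer B → A ⊑ B
⊆⇒⊑ (X , X⁺) (Y , Y⁺) X⊆Y X⁺⊆Y⁺ with ≡-dec _≟_ X Y
... | yes refl = inj₂ (refl , X⁺⊆Y⁺)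
... | no  X≢Y  = inj₁ (⊆∧≢⇒⊂ X⊆Y X≢Y)

∩̂-⊑ˡ : ∀ {n} (A B : Biset n) → (A ∩̂ B) ⊑ A
∩̂-⊑ˡ A@(X , X⁺) B@(Y , Y⁺) = ⊆⇒⊑ (A ∩̂ B) A (p∩q⊆p X Y) (p∩q⊆p X⁺ Y⁺)

∩̂-⊑ʳ : ∀ {n} (A B : Biset n) → (A ∩̂ B) ⊑ B
∩̂-⊑ʳ A@(X , X⁺) B@(Y , Y⁺) = ⊆⇒⊑ (A ∩̂ B) B (p∩q⊆q X Y) (p∩q⊆q X⁺ Y⁺)

-- Two cores of a crossing family that cross are equal: their intersection
-- is a member of F contained in both, hence equal to both by minimality.
crossing-cores-coincide : ∀ {n} (F : Family n) → Crossing F →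
  ∀ {A B} → IsCore F A → IsCore F B → Cross A B → A ≡ B
crossing-cores-coincide F crossing {A} {B} (A∈F , A-minimal) (B∈F , B-minimal) A×B =
  trans (sym A∩̂B≡A) A∩̂B≡B
  where
  A∩̂B∈F : (A ∩̂ B) ∈F F
  A∩̂B∈F = proj₁ (crossing A B A∈F B∈F A×B)

  A∩̂B≡A : A ∩̂ B ≡ A
  A∩̂B≡A = A-minimal (A ∩̂ B) A∩̂B∈F (∩̂-⊑ˡ A B)

  A∩̂B≡B : A ∩̂ B ≡ B
  A∩̂B≡B = B-minimal (A ∩̂ B) A∩̂B∈F (∩̂-⊑ʳ A B)

CoreThrough : ∀ {n} → Family n → Fin n → Biset n → Set
CoreThrough F v A = IsCore F A × v ∈ inner A

-- Distinct cores through a common point have disjoint bars: a point of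
-- X* ∩ Y* together with v would make the two cores cross.
distinct-cores-have-disjoint-bars : ∀ {n} (F : Family n) → Crossing F → ∀ v {A B} →
  CoreThrough F v A → CoreThrough F v B → A ≢ B →
  Empty (inner (bar A) ∩ inner (bar B))
distinct-cores-have-disjoint-bars F crossing v (A-core , v∈A) (B-core , v∈B) A≢B (x , x∈A*∩B*) =
  A≢B (crossing-cores-coincide F crossing A-core B-core ((v , x∈p∩q⁺ (v∈A , v∈B)) , (x , x∈A*∩B*)))

AllPairs-map-under-All : ∀ {a p r s} {A : Set a} {P : A → Set p}
  {R : A → A → Set r} {S : A → A → Set s} →
  (∀ {x y} → P x → P y → R x y → S x y) →
  ∀ {xs} → All P xs → AllPairs R xs → AllPairs S xs
AllPairs-map-under-All f [] [] = []
AllPairs-map-under-All f (px ∷ pxs) (Rx ∷ Rxs) =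
  All.zipWith (λ (py , Rxy) → f px py Rxy) (pxs , Rx) ∷ AllPairs-map-under-All f pxs Rxs

bars-of-cores-pack : ∀ {n} (F : Family n) → Crossing F → ∀ v {L} → Unique L →
  All (CoreThrough F v) L → Packing (barF F) (map bar L)
bars-of-cores-pack F crossing v distinct cores =
  Uniqueₚ.map⁺ bar-injective distinct ,
  Allₚ.map⁺ (All.map (∈-map⁺ bar ∘ proj₁ ∘ proj₁) cores) ,
  AllPairsₚ.map⁺ (AllPairs-map-under-All (distinct-cores-have-disjoint-bars F crossing v) cores distinct)

-- Main theorem: the packing of bars has the same length as L.  The
-- argument does not need the well-formedness X ⊆ X⁺ of the members.
lemma3p1 : (n : ℕ) (F : Family n) → WellFormed F → Crossing F →
    Δ≤ν (IsCore F) (barF F)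
lemma3p1 n F _ crossing v L distinct cores =
  map bar L , bars-of-cores-pack F crossing v distinct cores , ≤-reflexive (sym (length-map bar L))
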